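{- Let $(P,\leq,{}',0,1)$ be a generalized orthomodular poset and define $R(x,y):=LU(x',y)$ for all $x,y\in P$. Then $(P,\leq,{}',R,0,1)$ is a conditionally operator residuated poset satisfying operator divisibility.
   Context: For a poset $(P,\leq)$ and $A\subseteq P$, $L(A)=\{x\in P\mid x\leq a\text{ for all }a\in A\}$ and $U(A)=\{x\in P\mid a\leq x\text{ for all }a\in A\}$; we write $L(a,b)=L(\{a,b\})$, $L(a,B)=L(\{a\}\cup B)$, $LU(A)=L(U(A))$, etc. A unary operation $'$ on a poset is an antitone involution if $x''=x$ and $x\leq y$ implies $y'\leq x'$; on a bounded poset it is a complementation if $L(x,x')=\{0\}$ and $U(x,x')=\{1\}$ for all $x$. An orthoposet is a bounded poset $(P,\leq,{}',0,1)$ with an antitone involution $'$ which is a complementation. A generalized orthomodular poset is an orthoposet such that for all $x,y\in P$, $x\leq y$ implies $U(y)=U(x,L(x',y))$. A conditionally operator residuated poset is a tuple $(P,\leq,{}',R,0,1)$ where $(P,\leq,0,1)$ is a bounded poset, $'$ is a unary antitone operation on $P$, and $R:P^2\to 2^P$ satisfies for all $x,y,z\in P$: (i) if $x'\leq y$ then $L(x,y)\subseteq L(z)$ implies $L(x)\subseteq R(y,z)$; (ii) if $z\leq y$ then $L(x)\subseteq R(y,z)$ implies $L(x,y)\subseteq L(z)$; (iii) $R(x,0)=L(x')$; (iv) $R(x'',x)=P$. It satisfies operator divisibility if $x\leq y$ implies $L(y,U(R(y,x)))=L(x)$ for all $x,y\in P$. -}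

module Defs where

open import Level using (Level; _⊔_; suc)
open import Relation.Binary.Bundles using (Poset)
open import Relation.Binary.PropositionalEquality using (_≡_)
open import Relation.Unary using (Pred; _⊆_) 
open import Data.Product using (_×_; _,_)
open import Data.Sum using (_⊎_)
open import Data.Unit using (⊤)

_≐_ : ∀ {a ℓ} {A : Set a} → Pred A ℓ → Pred A ℓ → Set (a ⊔ ℓ)
S ≐ T = (S ⊆ T) × (T ⊆ S)

record BoundedPoset (c ℓ : Level) : Set (suc (c ⊔ ℓ)) where
  field
    poset : Poset c c ℓ
  open Poset poset public
  field
    ≈-is-≡ : ∀ {x y} → x ≈ y → x ≡ y
    𝟎 𝟏 : Carrier
    𝟎-least : ∀ x → 𝟎 ≤ x
    𝟏-greatest : ∀ x → x ≤ 𝟏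

  L′ : Pred Carrier (c ⊔ ℓ) → Pred Carrier (c ⊔ ℓ)
  L′ A x = ∀ a → A a → x ≤ a

  U′ : Pred Carrier (c ⊔ ℓ) → Pred Carrier (c ⊔ ℓ)
  U′ A x = ∀ a → A a → a ≤ x

  sing : Carrier → Pred Carrier (c ⊔ ℓ)
  sing a x = Level.Lift ℓ (x ≡ a)

  pair : Carrier → Carrier → Pred Carrier (c ⊔ ℓ)
  pair a b x = Level.Lift ℓ ((x ≡ a) ⊎ (x ≡ b))

  L₁ : Carrier → Pred Carrier (c ⊔ ℓ)
  L₁ a = L′ (sing a)
  U₁ : Carrier → Pred Carrier (c ⊔ ℓ)
  U₁ a = U′ (sing a)
  L₂ : Carrier → Carrier → Pred Carrier (c ⊔ ℓ)
  L₂ a b = L′ (pair a b)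
  U₂ : Carrier → Carrier → Pred Carrier (c ⊔ ℓ)
  U₂ a b = U′ (pair a b)

  _◁_ : Carrier → Pred Carrier (c ⊔ ℓ) → Pred Carrier (c ⊔ ℓ)
  (a ◁ B) x = (x ≡ a) ⊎ B x

module _ {c ℓ : Level} (P : BoundedPoset c ℓ) where
  open BoundedPoset P

  IsAntitone : (Carrier → Carrier) → Set (c ⊔ ℓ)
  IsAntitone f = ∀ {x y} → x ≤ y → f y ≤ f x

  IsAntitoneInvolution : (Carrier → Carrier) → Set (c ⊔ ℓ)
  IsAntitoneInvolution f = (∀ x → f (f x) ≡ x) × IsAntitone f

  IsComplementation : (Carrier → Carrier) → Set (c ⊔ ℓ)
  IsComplementation f = ∀ x → (L₂ x (f x) ≐ sing 𝟎) × (U₂ x (f x) ≐ sing 𝟏)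

  IsOrthoposet : (Carrier → Carrier) → Set (c ⊔ ℓ)
  IsOrthoposet f = IsAntitoneInvolution f × IsComplementation f

  -- generalized orthomodular poset:
  -- x ≤ y implies U(y) = U(x, L(x', y)), i.e. U({x} ∪ L(x',y))
  IsGeneralizedOrthomodular : (Carrier → Carrier) → Set (c ⊔ ℓ)
  IsGeneralizedOrthomodular f =
    IsOrthoposet f ×
    (∀ {x y} → x ≤ y → U₁ y ≐ U′ (x ◁ L₂ (f x) y))

  IsCondOperatorResiduated :
    (Carrier → Carrier) → (Carrier → Carrier → Pred Carrier (c ⊔ ℓ)) → Set (c ⊔ ℓ)
  IsCondOperatorResiduated f R =
    IsAntitone f ×
    (∀ x y z → f x ≤ y → L₂ x y ⊆ L₁ z → L₁ x ⊆ R y z) ×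
    (∀ x y z → z ≤ y → L₁ x ⊆ R y z → L₂ x y ⊆ L₁ z) ×
    (∀ x → R x 𝟎 ≐ L₁ (f x)) ×
    (∀ x → R (f (f x)) x ≐ (λ _ → Level.Lift (c ⊔ ℓ) ⊤))

  OperatorDivisibility : (Carrier → Carrier → Pred Carrier (c ⊔ ℓ)) → Set (c ⊔ ℓ)
  OperatorDivisibility R = ∀ {x y} → x ≤ y → L′ (y ◁ U′ (R y x)) ≐ L₁ x

module Submission where

-- Everything rests on one consequence of generalized orthomodularity: if a′ ≤ b, then every
-- common upper bound of a′ and of the lower bounds of {a, b} is above b.  Applied with
-- a = y, b = z′, it shows that for z ≤ y the only elements of L(y) ∩ LU(y′, z) are the
-- lower bounds of z; this gives axiom (ii) and operator divisibility.  Applied with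
-- a = y, b = x, it gives axiom (i).  Axioms (iii) and (iv) only need U(x′, 0) = U(x′) and
-- U(x′, x) = {1}.

open import Defs
open import Level using (Level; Lift; lift; lower; _⊔_)
open import Data.Product using (_×_; _,_; proj₁; proj₂)
open import Data.Sum using (inj₁; inj₂)
open import Data.Unit using (⊤; tt)
open import Relation.Unary using (Pred; _⊆_)
open import Relation.Binary.PropositionalEquality using (_≡_; refl; sym; subst; subst₂)

module Cones {c ℓ : Level} (P : BoundedPoset c ℓ) where
  open BoundedPoset P renaming (refl to ≤-refl)

  ∈sing : ∀ {a} → sing a a
  ∈sing = lift refl

  ∈pair-left : ∀ {a b} → pair a b a
  ∈pair-left = lift (inj₁ refl)

  ∈pair-right : ∀ {a b} → pair a b b
  ∈pair-right = lift (inj₂ refl)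

  L₁-intro : ∀ {a w} → w ≤ a → L₁ a w
  L₁-intro w≤a _ (lift refl) = w≤a

  L₂-intro : ∀ {a b w} → w ≤ a → w ≤ b → L₂ a b w
  L₂-intro w≤a w≤b _ (lift (inj₁ refl)) = w≤a
  L₂-intro w≤a w≤b _ (lift (inj₂ refl)) = w≤b

  U₂-intro : ∀ {a b u} → a ≤ u → b ≤ u → U₂ a b u
  U₂-intro a≤u b≤u _ (lift (inj₁ refl)) = a≤u
  U₂-intro a≤u b≤u _ (lift (inj₂ refl)) = b≤u

  ⊆LU : ∀ {A} → A ⊆ L′ (U′ A)
  ⊆LU a∈A u u∈UA = u∈UA _ a∈A

  U⊆ULU : ∀ {A} → U′ A ⊆ U′ (L′ (U′ A))
  U⊆ULU u∈UA t t∈LUA = t∈LUA _ u∈UA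

module AntitoneInvolution {c ℓ : Level} (P : BoundedPoset c ℓ)
  (_′ : BoundedPoset.Carrier P → BoundedPoset.Carrier P)
  (involutive : ∀ x → (x ′) ′ ≡ x) (antitone : IsAntitone P _′) where
  open BoundedPoset P renaming (refl to ≤-refl)

  ′-reflects-≤ : ∀ {x y} → x ′ ≤ y ′ → y ≤ x
  ′-reflects-≤ {x} {y} p = subst₂ _≤_ (involutive y) (involutive x) (antitone p)

  ≤′-swap : ∀ {x y} → x ≤ y ′ → y ≤ x ′
  ≤′-swap {x} {y} p = subst (_≤ x ′) (involutive y) (antitone p)

  ′≤-swap : ∀ {x y} → x ′ ≤ y → y ′ ≤ x
  ′≤-swap {x} {y} p = subst (y ′ ≤_) (involutive x) (antitone p)

module GeneralizedOrthomodular {c ℓ : Level} (P : BoundedPoset c ℓ)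
  (_′ : BoundedPoset.Carrier P → BoundedPoset.Carrier P)
  (gom : IsGeneralizedOrthomodular P _′) where
  open BoundedPoset P renaming (refl to ≤-refl)
  open Cones P

  involutive : ∀ x → (x ′) ′ ≡ x
  involutive = proj₁ (proj₁ (proj₁ gom))

  antitone : IsAntitone P _′
  antitone = proj₂ (proj₁ (proj₁ gom))

  complemented : IsComplementation P _′
  complemented = proj₂ (proj₁ gom)

  orthomodular : ∀ {x y} → x ≤ y → U₁ y ≐ U′ (x ◁ L₂ (x ′) y)
  orthomodular = proj₂ gom

  open AntitoneInvolution P _′ involutive antitone

  R : Carrier → Carrier → Pred Carrier (c ⊔ ℓ)
  R x y = L′ (U₂ (x ′) y)

  upper-bound-criterion : ∀ {a b u} → a ′ ≤ b → a ′ ≤ u →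
                          (∀ {t} → t ≤ a → t ≤ b → t ≤ u) → b ≤ u
  upper-bound-criterion {a} {b} {u} a′≤b a′≤u lower⇒≤u =
    proj₂ (orthomodular a′≤b) u∈U b ∈sing
    where
    u∈U : U′ ((a ′) ◁ L₂ ((a ′) ′) b) u
    u∈U _ (inj₁ refl) = a′≤u
    u∈U t (inj₂ t∈L) =
      lower⇒≤u (subst (t ≤_) (involutive a) (t∈L _ ∈pair-left)) (t∈L _ ∈pair-right)

  R-below⇒≤ : ∀ {y z w} → z ≤ y → w ≤ y → R y z w → w ≤ z
  R-below⇒≤ {y} {z} {w} z≤y w≤y w∈R =
    ′-reflects-≤ (upper-bound-criterion (antitone z≤y) (antitone w≤y) t≤w′)
    where
    t≤w′ : ∀ {t} → t ≤ y → t ≤ z ′ → t ≤ w ′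
    t≤w′ t≤y t≤z′ = ≤′-swap (w∈R _ (U₂-intro (antitone t≤y) (≤′-swap t≤z′)))

  L₂⊆L₁⇒L₁⊆R : ∀ x y z → x ′ ≤ y → L₂ x y ⊆ L₁ z → L₁ x ⊆ R y z
  L₂⊆L₁⇒L₁⊆R x y z x′≤y L₂xy⊆L₁z w∈L₁x u u∈U =
    trans (w∈L₁x x ∈sing) (upper-bound-criterion (′≤-swap x′≤y) (u∈U _ ∈pair-left) t≤u)
    where
    t≤u : ∀ {t} → t ≤ y → t ≤ x → t ≤ u
    t≤u t≤y t≤x = trans (L₂xy⊆L₁z (L₂-intro t≤x t≤y) z ∈sing) (u∈U _ ∈pair-right)

  L₁⊆R⇒L₂⊆L₁ : ∀ x y z → z ≤ y → L₁ x ⊆ R y z → L₂ x y ⊆ L₁ z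
  L₁⊆R⇒L₂⊆L₁ x y z z≤y L₁x⊆R w∈L₂ =
    L₁-intro (R-below⇒≤ z≤y (w∈L₂ y ∈pair-right) (L₁x⊆R (L₁-intro (w∈L₂ x ∈pair-left))))

  R-𝟎 : ∀ x → R x 𝟎 ≐ L₁ (x ′)
  R-𝟎 x = (λ w∈R → L₁-intro (w∈R _ (U₂-intro ≤-refl (𝟎-least _))))
        , (λ w∈L u u∈U → trans (w∈L _ ∈sing) (u∈U _ ∈pair-left))

  R-full : ∀ x → R ((x ′) ′) x ≐ (λ _ → Lift (c ⊔ ℓ) ⊤)
  R-full x = (λ _ → lift tt) , w∈R
    where
    w∈R : ∀ {w} → Lift (c ⊔ ℓ) ⊤ → R ((x ′) ′) x w
    w∈R {w} _ u u∈U = subst (w ≤_) (sym u≡𝟏) (𝟏-greatest w)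
      where
      u≡𝟏 : u ≡ 𝟏
      u≡𝟏 = lower (proj₁ (proj₂ (complemented x))
              (U₂-intro (u∈U _ ∈pair-right) (subst (_≤ u) (involutive (x ′)) (u∈U _ ∈pair-left))))

  operatorDivisibility : OperatorDivisibility P R
  operatorDivisibility {x} {y} x≤y = sound , complete
    where
    sound : L′ (y ◁ U′ (R y x)) ⊆ L₁ x
    sound w∈L = L₁-intro (R-below⇒≤ x≤y (w∈L y (inj₁ refl))
                                       (λ u u∈U → w∈L u (inj₂ (U⊆ULU u∈U))))

    complete : L₁ x ⊆ L′ (y ◁ U′ (R y x))
    complete w∈L _ (inj₁ refl) = trans (w∈L x ∈sing) x≤y
    complete w∈L a (inj₂ a∈U) = trans (w∈L x ∈sing) (a∈U x (⊆LU ∈pair-right))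

mainTheorem1 : {c ℓ : Level} (P : BoundedPoset c ℓ) (_′ : BoundedPoset.Carrier P → BoundedPoset.Carrier P) → IsGeneralizedOrthomodular P _′ → let R = λ x y → BoundedPoset.L′ P (BoundedPoset.U₂ P (x ′) y) in IsCondOperatorResiduated P _′ R × OperatorDivisibility P R
mainTheorem1 P _′ gom =
  (antitone , L₂⊆L₁⇒L₁⊆R , L₁⊆R⇒L₂⊆L₁ , R-𝟎 , R-full) , operatorDivisibility
  where open GeneralizedOrthomodular P _′ gom
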